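{- Let $n\ge 3$ and let $H$ be a homomorphic image of the wheel graph $W_n$, i.e. there is a graph homomorphism $\phi:W_n\to H$ that is surjective on vertices. Then $H$ is 2-connected.
   Context: $W_n$ is the wheel graph on $n+1$ vertices: an $n$-cycle together with an additional vertex adjacent to all vertices of the cycle. A graph homomorphism maps edges to edges. A graph is 2-connected if it has at least 3 vertices, is connected, and remains connected after deleting any single vertex. -}

module Defs where

open import Data.Nat using (ℕ; zero; suc; _≤_; _%_; NonZero)
open import Data.Fin using (Fin; zero; suc; toℕ)
open import Data.Product using (Σ; ∃; _×_)
open import Data.Sum using (_⊎_)
open import Relation.Binary.PropositionalEquality using (_≡_; _≢_)
open import Relation.Nullary using (¬_)
open import Data.Unit using (⊤)

record Graph (m : ℕ) : Set₁ where
  field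
    Adj     : Fin m → Fin m → Set
    symAdj  : ∀ {x y} → Adj x y → Adj y x
    irrefl  : ∀ {x} → ¬ Adj x x
open Graph public

-- Adjacency of the wheel W_n on vertex set Fin (suc n):
-- vertex zero is the hub, vertex (suc i) is the i-th cycle vertex (i : Fin n).
CycleSucc : (n : ℕ) → Fin n → Fin n → Set
CycleSucc n i j = (suc (toℕ i) ≡ toℕ j) ⊎ ((suc (toℕ i) ≡ n) × (toℕ j ≡ 0))

data WheelAdj (n : ℕ) : Fin (suc n) → Fin (suc n) → Set where
  hub-rim  : (i : Fin n) → WheelAdj n zero (suc i)
  rim-hub  : (i : Fin n) → WheelAdj n (suc i) zero
  rim-next : (i j : Fin n) → CycleSucc n i j → WheelAdj n (suc i) (suc j)
  rim-prev : (i j : Fin n) → CycleSucc n j i → WheelAdj n (suc i) (suc j)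

IsHomFromWheel : (n : ℕ) {m : ℕ} → Graph m → (Fin (suc n) → Fin m) → Set
IsHomFromWheel n H φ = ∀ u v → WheelAdj n u v → Adj H (φ u) (φ v)

Surjective : {a b : ℕ} → (Fin a → Fin b) → Set
Surjective {a} {b} φ = ∀ (y : Fin b) → Σ (Fin a) (λ x → φ x ≡ y)

data WalkIn {m : ℕ} (G : Graph m) (P : Fin m → Set) : Fin m → Fin m → Set where
  here : ∀ {x} → P x → WalkIn G P x x
  step : ∀ {x y z} → P x → Adj G x y → WalkIn G P y z → WalkIn G P x z

Connected : {m : ℕ} → Graph m → Set
Connected {m} G = ∀ (x y : Fin m) → WalkIn G (λ _ → ⊤) x y

ConnectedWithout : {m : ℕ} → Graph m → Fin m → Set
ConnectedWithout {m} G v = ∀ (x y : Fin m) → x ≢ v → y ≢ v → WalkIn G (λ w → w ≢ v) x y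

TwoConnected : {m : ℕ} → Graph m → Set
TwoConnected {m} G = (3 ≤ m) × Connected G × (∀ (v : Fin m) → ConnectedWithout G v)

module Submission where

-- The image h of the hub is adjacent to every other vertex of H, since every vertex
-- of H is the image of the hub or of a rim vertex. Hence H is connected, and stays
-- connected after deleting any vertex other than h, as all remaining vertices are
-- joined through h. After deleting h itself, note that no rim vertex maps to h (H is
-- loopless), so the image of the rim path is a walk avoiding h through every
-- remaining vertex. The hub together with two consecutive rim vertices is a
-- triangle, and its image provides three distinct vertices.

open import Defs
open import Data.Nat using (ℕ; suc; _≤_; s≤s)
open import Data.Fin using (Fin; zero; suc; inject₁; _≟_)
open import Data.Fin.Properties using (injective⇒≤; toℕ-inject₁)
open import Data.Fin.Induction using (<-weakInduction)
open import Data.Product using (_×_; _,_)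
open import Data.Sum using (inj₁)
open import Data.Unit using (tt)
open import Data.Empty using (⊥-elim)
open import Function.Definitions using (Injective)
open import Relation.Nullary using (yes; no)
open import Relation.Binary.PropositionalEquality using (_≡_; _≢_; refl; sym; cong)

module Walks {m : ℕ} (G : Graph m) {P : Fin m → Set} where

  _▻_ : ∀ {x y z} → WalkIn G P x y → P z × Adj G y z → WalkIn G P x z
  here px       ▻ (pz , y~z) = step px y~z (here pz)
  step px x~w w ▻ (pz , y~z) = step px x~w (w ▻ (pz , y~z))

  _◅◅_ : ∀ {x y z} → WalkIn G P x y → WalkIn G P y z → WalkIn G P x z
  here _        ◅◅ w′ = w′
  step px x~y w ◅◅ w′ = step px x~y (w ◅◅ w′)

  reverse : ∀ {x y} → WalkIn G P x y → WalkIn G P y x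
  reverse (here px)       = here px
  reverse (step px x~y w) = reverse w ▻ (px , symAdj G x~y)

  meetAt : ∀ {x y z} → WalkIn G P x z → WalkIn G P y z → WalkIn G P x y
  meetAt wx wy = wx ◅◅ reverse wy

open Walks using (meetAt)

adjacent⇒≢ : ∀ {m} (G : Graph m) {x y : Fin m} → Adj G x y → x ≢ y
adjacent⇒≢ G x~y refl = irrefl G x~y

distinct⇒3≤ : ∀ {m} {x y z : Fin m} → x ≢ y → x ≢ z → y ≢ z → 3 ≤ m
distinct⇒3≤ {m} {x} {y} {z} x≢y x≢z y≢z = injective⇒≤ f-injective
  where
  f : Fin 3 → Fin m
  f zero             = x
  f (suc zero)       = y
  f (suc (suc zero)) = z

  f-injective : Injective _≡_ _≡_ f
  f-injective {zero}             {zero}             _  = refl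
  f-injective {zero}             {suc zero}         eq = ⊥-elim (x≢y eq)
  f-injective {zero}             {suc (suc zero)}   eq = ⊥-elim (x≢z eq)
  f-injective {suc zero}         {zero}             eq = ⊥-elim (x≢y (sym eq))
  f-injective {suc zero}         {suc zero}         _  = refl
  f-injective {suc zero}         {suc (suc zero)}   eq = ⊥-elim (y≢z eq)
  f-injective {suc (suc zero)}   {zero}             eq = ⊥-elim (x≢z (sym eq))
  f-injective {suc (suc zero)}   {suc zero}         eq = ⊥-elim (y≢z (sym eq))
  f-injective {suc (suc zero)}   {suc (suc zero)}   _  = refl

triangle⇒3≤ : ∀ {m} (G : Graph m) {x y z : Fin m} →
              Adj G x y → Adj G x z → Adj G y z → 3 ≤ m
triangle⇒3≤ G x~y x~z y~z =
  distinct⇒3≤ (adjacent⇒≢ G x~y) (adjacent⇒≢ G x~z) (adjacent⇒≢ G y~z)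

Dominating : ∀ {m} → Graph m → Fin m → Set
Dominating {m} G h = ∀ (x : Fin m) → x ≢ h → Adj G x h

module DominatingVertex {m : ℕ} (G : Graph m) {h : Fin m} (dom : Dominating G h) where

  walkToDominating : ∀ {P : Fin m → Set} x → P x → P h → WalkIn G P x h
  walkToDominating x px ph with x ≟ h
  ... | yes refl = here px
  ... | no x≢h   = step px (dom x x≢h) (here ph)

  connected : Connected G
  connected x y = meetAt G (walkToDominating x tt tt) (walkToDominating y tt tt)

  connectedWithout : ∀ v → v ≢ h → ConnectedWithout G v
  connectedWithout v v≢h x y x≢v y≢v =
    meetAt G (walkToDominating x x≢v h≢v) (walkToDominating y y≢v h≢v)
    where
    h≢v : h ≢ v
    h≢v h≡v = v≢h (sym h≡v)

module WheelImage (n : ℕ) {m : ℕ} (H : Graph m) (φ : Fin (suc (suc n)) → Fin m)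
  (hom : IsHomFromWheel (suc n) H φ) (surj : Surjective φ) where

  hub : Fin m
  hub = φ zero

  hub-dominating : Dominating H hub
  hub-dominating x x≢hub with surj x
  ... | zero  , refl = ⊥-elim (x≢hub refl)
  ... | suc i , refl = hom _ _ (rim-hub i)

  rim≢hub : ∀ i → φ (suc i) ≢ hub
  rim≢hub i = adjacent⇒≢ H (hom _ _ (rim-hub i))

  rimWalkToFirst : ∀ {P : Fin m → Set} → (∀ i → P (φ (suc i))) →
                   ∀ i → WalkIn H P (φ (suc i)) (φ (suc zero))
  rimWalkToFirst {P} P-rim =
    <-weakInduction (λ i → WalkIn H P (φ (suc i)) (φ (suc zero)))
      (here (P-rim zero))
      (λ i → step (P-rim (suc i)) (hom _ _ (rim-prev (suc i) (inject₁ i) (inject₁-precedes i))))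
    where
    inject₁-precedes : ∀ i → CycleSucc (suc n) (inject₁ i) (suc i)
    inject₁-precedes i = inj₁ (cong suc (toℕ-inject₁ i))

  connectedWithoutHub : ConnectedWithout H hub
  connectedWithoutHub x y x≢hub y≢hub with surj x | surj y
  ... | zero  , refl | _            = ⊥-elim (x≢hub refl)
  ... | suc i , refl | zero  , refl = ⊥-elim (y≢hub refl)
  ... | suc i , refl | suc j , refl =
    meetAt H (rimWalkToFirst rim≢hub i) (rimWalkToFirst rim≢hub j)

  connectedWithout : ∀ v → ConnectedWithout H v
  connectedWithout v with v ≟ hub
  ... | yes refl = connectedWithoutHub
  ... | no v≢hub = DominatingVertex.connectedWithout H hub-dominating v v≢hub

lemma5p7 : (n : ℕ) → (3≤n : 3 ≤ n) → {m : ℕ} → (H : Graph m) → (φ : Fin (suc n) → Fin m) → IsHomFromWheel n H φ → Surjective φ → TwoConnected H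
lemma5p7 (suc (suc (suc n))) (s≤s (s≤s (s≤s _))) H φ hom surj =
    triangle⇒3≤ H (hom _ _ (hub-rim zero)) (hom _ _ (hub-rim (suc zero)))
                  (hom _ _ (rim-next zero (suc zero) (inj₁ refl)))
  , DominatingVertex.connected H hub-dominating
  , connectedWithout
  where open WheelImage (suc (suc n)) H φ hom surj
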